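{- Let $\prec$ be a linear ordering of the vertices of a reflexive graph $G$ and let $U_\prec=\{(u,v)\in Z(G): u\prec v\}$. The following are equivalent: (1) $\prec$ is a strong cocomparability ordering of $G$; (2) for all $(u,v),(u',v')\in Z(G)$ with $(u,v)\sim(u',v')$, we have $u\prec v$ if and only if $u'\prec v'$; (3) $U_\prec$ is a union of implication classes.
   Context: A reflexive graph is a finite undirected graph in which every vertex has a loop. A strong cocomparability ordering of $G$ is a vertex ordering $\prec$ such that there are no vertices $r_1\prec r_2$ and $c_1\prec c_2$ with $r_1c_1\notin E(G)$, $r_1c_2\in E(G)$, $r_2c_1\in E(G)$, $r_2c_2\notin E(G)$ (equivalently, the adjacency matrix with rows and columns ordered by $\prec$ has no submatrix equal to $\begin{pmatrix}0&1\\1&0\end{pmatrix}$). $Z(G)$ is the set of ordered pairs of distinct vertices. For $(u,v),(u',v')\in Z(G)$, $(u,v)\,\Lambda\,(u',v')$ means either $(u,v)=(u',v')$, or $uu',vv'\in E(G)$ and $uv',vu'\notin E(G)$. Write $(u,v)\sim(u',v')$ if there is a sequence $(u_1,v_1)=(u,v),(u_2,v_2),\dots,(u_k,v_k)=(u',v')$ of pairs in $Z(G)$ with $(u_i,v_i)\,\Lambda\,(u_{i+1},v_{i+1})$ for all $i$; $\sim$ is an equivalence relation on $Z(G)$ and its equivalence classes are called implication classes. -}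

module Defs where

open import Level using (Level; _⊔_) renaming (suc to lsuc; zero to lzero)
open import Data.Nat using (ℕ)
open import Data.Fin using (Fin)
open import Data.Product using (Σ; _×_; _,_; ∃)
open import Data.Empty using (⊥)
open import Data.Sum using (_⊎_)
open import Relation.Nullary using (¬_)
open import Relation.Binary.Core using (Rel)
open import Relation.Binary.Definitions using (Reflexive; Symmetric; Decidable)
open import Relation.Binary.PropositionalEquality using (_≡_; _≢_)
open import Relation.Binary.Construct.Closure.ReflexiveTransitive using (Star)

record ReflexiveGraph (n : ℕ) : Set₁ where
  field
    E      : Rel (Fin n) lzero
    sym    : Symmetric E
    loops  : Reflexive E
    E?     : Decidable E

module _ {n : ℕ} (G : ReflexiveGraph n) where
  open ReflexiveGraph G

  -- strong cocomparability ordering: no r₁ ≺ r₂, c₁ ≺ c₂ with the 0 1 / 1 0 pattern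
  StrongCocomparabilityOrdering : Rel (Fin n) lzero → Set
  StrongCocomparabilityOrdering _≺_ =
    ∀ r₁ r₂ c₁ c₂ → r₁ ≺ r₂ → c₁ ≺ c₂ →
      ¬ (¬ E r₁ c₁ × E r₁ c₂ × E r₂ c₁ × ¬ E r₂ c₂)

  Z : Set
  Z = Σ (Fin n × Fin n) (λ { (u , v) → u ≢ v })

  fst snd : Z → Fin n
  fst ((u , _) , _) = u
  snd ((_ , v) , _) = v

  Λ : Rel Z lzero
  Λ p q = (p ≡ q) ⊎ (E (fst p) (fst q) × E (snd p) (snd q)
                       × ¬ E (fst p) (snd q) × ¬ E (snd p) (fst q))

  _∼_ : Rel Z lzero
  _∼_ = Star Λ

  U : Rel (Fin n) lzero → Z → Set
  U _≺_ p = fst p ≺ snd p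

  ImplicationClass : Z → Z → Set
  ImplicationClass p q = p ∼ q

  IsUnionOfImplicationClasses : (Z → Set) → Set₁
  IsUnionOfImplicationClasses S =
    Σ (Z → Set) λ R → ∀ z → (S z → ∃ λ r → R r × ImplicationClass r z)
                          × ((∃ λ r → R r × ImplicationClass r z) → S z)

{-# OPTIONS --safe #-}
module Submission where

-- The submatrix (0 1 / 1 0) on rows r₁ ≺ r₂ and columns c₁ ≺ c₂ is exactly a step
-- (r₁,r₂) Λ (c₂,c₁) from a ≺-increasing to a ≺-decreasing pair.  So ≺ is a strong
-- cocomparability ordering iff membership in U_≺ is invariant under single Λ-steps
-- (Λ being symmetric), which is the same as invariance under its closure ∼; and the
-- ∼-invariant sets are precisely the unions of ∼-classes.

open import Defs
open import Level using () renaming (zero to lzero)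
open import Data.Nat using (ℕ)
open import Data.Fin using (Fin)
open import Data.Product using (_×_; _,_; proj₁; proj₂)
open import Data.Sum using (inj₁; inj₂)
open import Data.Empty using (⊥-elim)
open import Function.Bundles using (_⇔_; mk⇔; Equivalence)
open import Function.Construct.Composition using (_⇔-∘_)
open import Function.Properties.Equivalence using (⇔-isEquivalence)
open import Relation.Binary.Core using (Rel)
open import Relation.Binary.Definitions using (Symmetric; tri<; tri≈; tri>)
open import Relation.Binary.Structures using (IsStrictTotalOrder; IsEquivalence)
open import Relation.Binary.PropositionalEquality as ≡ using (_≡_)
open import Relation.Binary.Construct.Closure.ReflexiveTransitive
  using (Star; ε; _◅◅_; fold; return; reverse)

private
  module ⇔ = IsEquivalence (⇔-isEquivalence {lzero})

Invariant : {A : Set} → Rel A lzero → (A → Set) → Set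
Invariant R S = ∀ p q → R p q → (S p ⇔ S q)

invariant⇔Star-invariant : {A : Set} (R : Rel A lzero) (S : A → Set) →
  Invariant R S ⇔ Invariant (Star R) S
invariant⇔Star-invariant R S = mk⇔
  (λ inv p q → fold (λ p q → S p ⇔ S q) (λ r eq → ⇔.trans (inv _ _ r) eq) ⇔.refl)
  (λ inv p q r → inv p q (return r))

module _ {n : ℕ} (G : ReflexiveGraph n) where
  open ReflexiveGraph G renaming (sym to E-sym)

  Λ-sym : Symmetric (Λ G)
  Λ-sym (inj₁ ≡.refl) = inj₁ ≡.refl
  Λ-sym (inj₂ (uu' , vv' , ¬uv' , ¬vu')) =
    inj₂ (E-sym uu' , E-sym vv' , (λ e → ¬vu' (E-sym e)) , (λ e → ¬uv' (E-sym e)))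

  ∼-invariant⇔isUnionOfImplicationClasses : (S : Z G → Set) →
    Invariant (_∼_ G) S ⇔ IsUnionOfImplicationClasses G S
  ∼-invariant⇔isUnionOfImplicationClasses S = mk⇔ classesOf fromClasses
    where
    classesOf : Invariant (_∼_ G) S → IsUnionOfImplicationClasses G S
    classesOf inv = S , λ z →
      (λ Sz → z , Sz , ε) , λ { (r , Sr , r∼z) → Equivalence.to (inv r z r∼z) Sr }

    fromClasses : IsUnionOfImplicationClasses G S → Invariant (_∼_ G) S
    fromClasses (R , covers) p q p∼q = mk⇔ (transport p∼q) (transport (reverse Λ-sym p∼q))
      where
      transport : ∀ {p q} → _∼_ G p q → S p → S q
      transport {p} {q} p∼q Sp =
        let (r , Rr , r∼p) = proj₁ (covers p) Sp in proj₂ (covers q) (r , Rr , r∼p ◅◅ p∼q)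

  module _ (_≺_ : Rel (Fin n) lzero) (≺-strictTotalOrder : IsStrictTotalOrder _≡_ _≺_) where
    open IsStrictTotalOrder ≺-strictTotalOrder using (compare; irrefl; asym)

    sco⇒Λ-preserves-U : StrongCocomparabilityOrdering G _≺_ →
      ∀ {p q} → Λ G p q → U G _≺_ p → U G _≺_ q
    sco⇒Λ-preserves-U sco (inj₁ ≡.refl) u≺v = u≺v
    sco⇒Λ-preserves-U sco {(u , v) , _} {(u' , v') , u'≢v'} (inj₂ (uu' , vv' , ¬uv' , ¬vu')) u≺v
      with compare u' v'
    ... | tri< u'≺v' _ _ = u'≺v'
    ... | tri≈ _ u'≡v' _ = ⊥-elim (u'≢v' u'≡v')
    ... | tri> _ _ v'≺u' = ⊥-elim (sco u v v' u' u≺v v'≺u' (¬uv' , uu' , vv' , ¬vu'))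

    sco⇒U-Λ-invariant : StrongCocomparabilityOrdering G _≺_ → Invariant (Λ G) (U G _≺_)
    sco⇒U-Λ-invariant sco p q pΛq =
      mk⇔ (sco⇒Λ-preserves-U sco pΛq) (sco⇒Λ-preserves-U sco (Λ-sym pΛq))

    U-Λ-invariant⇒sco : Invariant (Λ G) (U G _≺_) → StrongCocomparabilityOrdering G _≺_
    U-Λ-invariant⇒sco inv r₁ r₂ c₁ c₂ r₁≺r₂ c₁≺c₂ (¬r₁c₁ , r₁c₂ , r₂c₁ , ¬r₂c₂) =
      asym c₁≺c₂ (Equivalence.to (inv r r' (inj₂ (r₁c₂ , r₂c₁ , ¬r₁c₁ , ¬r₂c₂))) r₁≺r₂)
      where
      r r' : Z G
      r  = (r₁ , r₂) , λ r₁≡r₂ → irrefl r₁≡r₂ r₁≺r₂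
      r' = (c₂ , c₁) , λ c₂≡c₁ → irrefl (≡.sym c₂≡c₁) c₁≺c₂

    sco⇔U-Λ-invariant : StrongCocomparabilityOrdering G _≺_ ⇔ Invariant (Λ G) (U G _≺_)
    sco⇔U-Λ-invariant = mk⇔ sco⇒U-Λ-invariant U-Λ-invariant⇒sco

proposition8 : {n : ℕ} (G : ReflexiveGraph n) (_≺_ : Rel (Fin n) _) →
    IsStrictTotalOrder _≡_ _≺_ →
    (StrongCocomparabilityOrdering G _≺_
      ⇔ (∀ (p q : Z G) → _∼_ G p q → (U G _≺_ p ⇔ U G _≺_ q)))
    × ((∀ (p q : Z G) → _∼_ G p q → (U G _≺_ p ⇔ U G _≺_ q))
      ⇔ IsUnionOfImplicationClasses G (U G _≺_))
proposition8 G _≺_ ≺-strictTotalOrder =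
    invariant⇔Star-invariant (Λ G) (U G _≺_) ⇔-∘ sco⇔U-Λ-invariant G _≺_ ≺-strictTotalOrder
  , ∼-invariant⇔isUnionOfImplicationClasses G (U G _≺_)
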